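{- Let $q$ be a prime power, $n$ a positive integer, $E=\mathbb{F}_q^n$, and let $M=(E,\rho)$ be a $q$-matroid. Let $B_1,B_2$ be bases of $M$ with $B_1\neq B_2$ and let $y\in B_2\setminus B_1$. Then there exist a subspace $U$ of $E$ and a vector $x\in B_1\setminus B_2$ such that $B_1\cap B_2\subseteq U$, $B_1=U\oplus\langle x\rangle$ (i.e. $B_1=U+\langle x\rangle$ and $U\cap\langle x\rangle=\{\mathbf{0}\}$), and $U\oplus\langle y\rangle$ is a basis of $M$.
   Context: Let $\Sigma(E)$ denote the set of all $\mathbb{F}_q$-subspaces of $E$. A $q$-matroid on $E$ is a pair $M=(E,\rho)$ where $\rho:\Sigma(E)\to\mathbb{N}$ satisfies: (r1) $0\le\rho(A)\le\dim A$ for all $A$; (r2) $A\subseteq B$ implies $\rho(A)\le\rho(B)$; (r3) $\rho(A+B)+\rho(A\cap B)\le\rho(A)+\rho(B)$ for all $A,B$. A subspace $A$ is independent if $\rho(A)=\dim A$, and a basis if it is independent and $\rho(A)=\rho(E)$. For vectors $y_1,\dots,y_r$, $\langle y_1,\dots,y_r\rangle$ denotes their $\mathbb{F}_q$-span. -}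

module Defs where

open import Level using (Level; _⊔_) renaming (suc to lsuc)
open import Algebra.Bundles using (CommutativeRing)
open import Data.Nat using (ℕ; zero; suc; _≤_; _^_) renaming (_+_ to _+ℕ_)
open import Data.Nat.Primality using (Prime)
open import Data.Fin using (Fin)
import Data.Fin as F
open import Data.Product using (Σ; ∃; _×_; _,_)
open import Data.Unit.Polymorphic using (⊤)
open import Relation.Nullary using (¬_)
open import Relation.Binary.PropositionalEquality using (_≡_)

record IsField {c ℓ : Level} (R : CommutativeRing c ℓ) : Set (c ⊔ ℓ) where
  open CommutativeRing R
  field
    1≉0     : ¬ (1# ≈ 0#)
    inverse : ∀ x → ¬ (x ≈ 0#) → ∃ λ y → x * y ≈ 1#

record HasCardinality {c ℓ : Level} (R : CommutativeRing c ℓ) (q : ℕ) : Set (c ⊔ ℓ) where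
  open CommutativeRing R
  field
    enum       : Fin q → Carrier
    surjective : ∀ x → ∃ λ i → enum i ≈ x
    injective  : ∀ i j → enum i ≈ enum j → i ≡ j

IsPrimePower : ℕ → Set
IsPrimePower q = Σ ℕ λ p → Σ ℕ λ k → Prime p × (1 ≤ k) × (q ≡ p ^ k)

module Linear {c ℓ : Level} (R : CommutativeRing c ℓ) (n : ℕ) where
  open CommutativeRing R

  Vect : Set c
  Vect = Fin n → Carrier

  _≈ᵥ_ : Vect → Vect → Set ℓ
  u ≈ᵥ v = ∀ i → u i ≈ v i

  0ᵥ : Vect
  0ᵥ _ = 0#

  _+ᵥ_ : Vect → Vect → Vect
  (u +ᵥ v) i = u i + v i

  _·_ : Carrier → Vect → Vect
  (a · v) i = a * v i

  infix 4 _≈ᵥ_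
  infixl 6 _+ᵥ_
  infixl 7 _·_

  record Subspace : Set (lsuc (c ⊔ ℓ)) where
    field
      mem    : Vect → Set (c ⊔ ℓ)
      ∈-resp : ∀ {u v} → u ≈ᵥ v → mem u → mem v
      0∈     : mem 0ᵥ
      +∈     : ∀ {u v} → mem u → mem v → mem (u +ᵥ v)
      ·∈     : ∀ a {v} → mem v → mem (a · v)

  infix 4 _∈ₛ_
  _∈ₛ_ : Vect → Subspace → Set (c ⊔ ℓ)
  v ∈ₛ A = Subspace.mem A v

  full : Subspace
  full = record
    { mem = λ _ → ⊤ ; ∈-resp = λ _ _ → _ ; 0∈ = _ ; +∈ = λ _ _ → _ ; ·∈ = λ _ _ → _ }

  _⊆_ : Subspace → Subspace → Set (c ⊔ ℓ)
  A ⊆ B = ∀ v → v ∈ₛ A → v ∈ₛ B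

  _≐_ : Subspace → Subspace → Set (c ⊔ ℓ)
  A ≐ B = A ⊆ B × B ⊆ A

  lincomb : (d : ℕ) → (Fin d → Carrier) → (Fin d → Vect) → Vect
  lincomb zero    a v = 0ᵥ
  lincomb (suc d) a v = a F.zero · v F.zero +ᵥ lincomb d (λ i → a (F.suc i)) (λ i → v (F.suc i))

  HasDim : Subspace → ℕ → Set (c ⊔ ℓ)
  HasDim A d = Σ (Fin d → Vect) λ b →
      (∀ i → b i ∈ₛ A)
    × (∀ a → lincomb d a b ≈ᵥ 0ᵥ → ∀ i → a i ≈ 0#)
    × (∀ v → v ∈ₛ A → ∃ λ a → v ≈ᵥ lincomb d a b)

  IsSum : Subspace → Subspace → Subspace → Set (c ⊔ ℓ)
  IsSum S A B = ∀ v → (v ∈ₛ S → Σ Vect λ a → Σ Vect λ b → a ∈ₛ A × b ∈ₛ B × v ≈ᵥ a +ᵥ b)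
                    × ((Σ Vect λ a → Σ Vect λ b → a ∈ₛ A × b ∈ₛ B × v ≈ᵥ a +ᵥ b) → v ∈ₛ S)

  IsIntersection : Subspace → Subspace → Subspace → Set (c ⊔ ℓ)
  IsIntersection I A B = ∀ v → (v ∈ₛ I → v ∈ₛ A × v ∈ₛ B) × (v ∈ₛ A × v ∈ₛ B → v ∈ₛ I)

  IsDirectSumLine : Subspace → Subspace → Vect → Set (c ⊔ ℓ)
  IsDirectSumLine S U x =
      (∀ v → (v ∈ₛ S → Σ Vect λ u → Σ Carrier λ a → u ∈ₛ U × v ≈ᵥ u +ᵥ a · x)
           × ((Σ Vect λ u → Σ Carrier λ a → u ∈ₛ U × v ≈ᵥ u +ᵥ a · x) → v ∈ₛ S))
    × (∀ v → v ∈ₛ U → (Σ Carrier λ a → v ≈ᵥ a · x) → v ≈ᵥ 0ᵥ)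

  record IsQMatroid (ρ : Subspace → ℕ) : Set (lsuc (c ⊔ ℓ)) where
    field
      r1 : ∀ A d → HasDim A d → ρ A ≤ d
      r2 : ∀ A B → A ⊆ B → ρ A ≤ ρ B
      r3 : ∀ A B S I → IsSum S A B → IsIntersection I A B → ρ S +ℕ ρ I ≤ ρ A +ℕ ρ B

  Independent : (Subspace → ℕ) → Subspace → Set (c ⊔ ℓ)
  Independent ρ A = Σ ℕ λ d → HasDim A d × ρ A ≡ d

  IsBasis : (Subspace → ℕ) → Subspace → Set (c ⊔ ℓ)
  IsBasis ρ A = Independent ρ A × ρ A ≡ ρ full

-- Write cl V for the q-matroid closure of V (the vectors v with ρ (V + ⟨v⟩) = ρ V) and let
-- I = B₁ ∩ B₂.  A hyperplane of B₂ that contains I but not y has rank dim B₂ − 1, so y is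
-- not in its closure, nor in cl I.  Adding the vectors of a basis of B₁ to I one at a time,
-- y eventually lies in the closure, which yields I ⊆ V ⊆ B₁ and x ∈ B₁ with y ∉ cl V but
-- y ∈ cl (V + ⟨x⟩); in particular x ∉ V, hence x ∉ B₂.  Let U be a hyperplane of B₁ with
-- V ⊆ U and x ∉ U, so B₁ = U ⊕ ⟨x⟩ and x ∉ cl U.  If y were in cl U, submodularity applied
-- to U + ⟨y⟩ and V + ⟨x⟩ + ⟨y⟩ would put x in cl U.  So ρ (U ⊕ ⟨y⟩) = dim U + 1 = ρ B₁,
-- and U ⊕ ⟨y⟩ is a basis.
--
-- The argument is constructive: finiteness of the field is used only to decide membership
-- in subspaces, by searching all coefficient vectors, which the construction of the
-- separating hyperplanes needs.

module Submission where

open import Defs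
open import Level using (Level; _⊔_) renaming (suc to lsuc)
open import Algebra.Bundles using (CommutativeRing)
open import Data.Nat using (ℕ; zero; suc; _≤_) renaming (_+_ to _+ℕ_)
import Data.Nat.Properties as ℕP
open import Data.Fin using (Fin; zero; suc)
import Data.Fin.Properties as FinP
open import Data.Vec.Functional using (Vector; _∷_; head; tail)
open import Data.Empty using (⊥-elim)
open import Data.Product using (Σ; ∃; _×_; _,_; proj₁; proj₂)
open import Data.Sum using (_⊎_; inj₁; inj₂)
open import Function using (_∘_; id)
import Relation.Binary.Reasoning.Setoid as SetoidReasoning
open import Relation.Nullary using (¬_; Dec; yes; no; ¬?; _×-dec_)
open import Relation.Nullary.Decidable using (map′; decidable-stable)
open import Relation.Binary.Definitions using (Decidable)
open import Relation.Binary.PropositionalEquality as ≡ using (_≡_)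

module FiniteField {c ℓ : Level} (R : CommutativeRing c ℓ) {q : ℕ} (card : HasCardinality R q) where
  open CommutativeRing R
  open HasCardinality card

  infix 4 _≟_
  _≟_ : Decidable _≈_
  x ≟ y with surjective x | surjective y
  ... | i , enumᵢ≈x | j , enumⱼ≈y =
    map′ (λ { ≡.refl → trans (sym enumᵢ≈x) enumⱼ≈y })
         (λ x≈y → injective i j (trans enumᵢ≈x (trans x≈y (sym enumⱼ≈y))))
         (i FinP.≟ j)

  ∃-coefficients? : ∀ {p} m (P : Vector Carrier m → Set p)
                  → (∀ {a a′} → (∀ i → a i ≈ a′ i) → P a → P a′)
                  → (∀ a → Dec (P a)) → Dec (∃ P)
  ∃-coefficients? zero P resp P? =
    map′ (λ p → _ , p) (λ (a , p) → resp (λ ()) p) (P? (λ ()))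
  ∃-coefficients? (suc m) P resp P? =
    map′ (λ (i , a , p) → enum i ∷ a , p) from
         (FinP.any? λ i → ∃-coefficients? m (P ∘ (enum i ∷_)) (resp ∘ cons-cong) (P? ∘ (enum i ∷_)))
    where
    cons-cong : ∀ {x a a′} → (∀ i → a i ≈ a′ i) → ∀ i → (x ∷ a) i ≈ (x ∷ a′) i
    cons-cong a≈a′ zero    = refl
    cons-cong a≈a′ (suc i) = a≈a′ i

    from : ∃ P → ∃ λ i → ∃ (P ∘ (enum i ∷_))
    from (a , p) with surjective (head a)
    ... | i , enumᵢ≈a₀ = i , tail a , resp (λ { zero → sym enumᵢ≈a₀ ; (suc j) → refl }) p

module Subspaces {c ℓ : Level} (R : CommutativeRing c ℓ) (n : ℕ) where
  open CommutativeRing R hiding (zero)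
  open Linear R n
  open Subspace using (∈-resp; 0∈; +∈; ·∈)
  open import Algebra.Solver.Ring.NaturalCoefficients.Default commutativeSemiring
    using (solve; _:+_; _:*_; _:=_)
  open import Algebra.Properties.CommutativeSemigroup +-commutativeSemigroup
    using () renaming (interchange to +-interchange)

  +*-cancel : ∀ {a b} x w → a + b ≈ 0# → (x + a * w) + b * w ≈ x
  +*-cancel {a} {b} x w a+b≈0 = begin
    (x + a * w) + b * w  ≈⟨ +-assoc x _ _ ⟩
    x + (a * w + b * w)  ≈⟨ +-congˡ (distribʳ w a b) ⟨
    x + (a + b) * w      ≈⟨ +-congˡ (*-congʳ a+b≈0) ⟩
    x + 0# * w           ≈⟨ +-congˡ (zeroˡ w) ⟩
    x + 0#               ≈⟨ +-identityʳ x ⟩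
    x                    ∎
    where open SetoidReasoning setoid

  *-vanishˡ : ∀ {a x u} → a ≈ 0# → a * x + u ≈ u
  *-vanishˡ {x = x} {u} a≈0 = trans (+-congʳ (trans (*-congʳ a≈0) (zeroˡ x))) (+-identityˡ u)

  *-vanishʳ : ∀ {a x u} → a ≈ 0# → u + a * x ≈ u
  *-vanishʳ {x = x} {u} a≈0 = trans (+-congˡ (trans (*-congʳ a≈0) (zeroˡ x))) (+-identityʳ u)

  -- Opaque, so that comparing subspaces built from these identities never unfolds the
  -- solver's proofs.
  opaque
    *+-distrib-+ : ∀ x x′ y l l′ → (x + x′) * y + (l + l′) ≈ (x * y + l) + (x′ * y + l′)
    *+-distrib-+ = solve 5 (λ x x′ y l l′ → (x :+ x′) :* y :+ (l :+ l′) := (x :* y :+ l) :+ (x′ :* y :+ l′))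
                           refl

    *+-distrib-* : ∀ k x y l → (k * x) * y + k * l ≈ k * (x * y + l)
    *+-distrib-* = solve 4 (λ k x y l → (k :* x) :* y :+ k :* l := k :* (x :* y :+ l)) refl

    +*-distrib-+ : ∀ u a u′ a′ w → (u + a * w) + (u′ + a′ * w) ≈ (u + u′) + (a + a′) * w
    +*-distrib-+ = solve 5 (λ u a u′ a′ w → (u :+ a :* w) :+ (u′ :+ a′ :* w) := (u :+ u′) :+ (a :+ a′) :* w)
                           refl

    +*-distrib-* : ∀ k u a w → k * (u + a * w) ≈ k * u + (k * a) * w
    +*-distrib-* = solve 4 (λ k u a w → k :* (u :+ a :* w) := k :* u :+ (k :* a) :* w) refl

  lincomb-cong : ∀ m {a a′} (g : Vector Vect m) → (∀ i → a i ≈ a′ i) → lincomb m a g ≈ᵥ lincomb m a′ g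
  lincomb-cong zero    g a≈a′ j = refl
  lincomb-cong (suc m) g a≈a′ j =
    +-cong (*-congʳ (a≈a′ zero)) (lincomb-cong m (tail g) (a≈a′ ∘ suc) j)

  lincomb-zero : ∀ m (g : Vector Vect m) → lincomb m (λ _ → 0#) g ≈ᵥ 0ᵥ
  lincomb-zero zero    g j = refl
  lincomb-zero (suc m) g j =
    trans (+-cong (zeroˡ _) (lincomb-zero m (tail g) j)) (+-identityˡ 0#)

  lincomb-+ : ∀ m a a′ (g : Vector Vect m) →
              lincomb m (λ i → a i + a′ i) g ≈ᵥ lincomb m a g +ᵥ lincomb m a′ g
  lincomb-+ zero    a a′ g j = sym (+-identityˡ 0#)
  lincomb-+ (suc m) a a′ g j =
    trans (+-congˡ (lincomb-+ m (tail a) (tail a′) (tail g) j))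
          (*+-distrib-+ (head a) (head a′) (head g j) _ _)

  lincomb-· : ∀ m k a (g : Vector Vect m) → lincomb m (λ i → k * a i) g ≈ᵥ k · lincomb m a g
  lincomb-· zero    k a g j = sym (zeroʳ k)
  lincomb-· (suc m) k a g j =
    trans (+-congˡ (lincomb-· m k (tail a) (tail g) j))
          (*+-distrib-* k (head a) (head g j) _)

  lincomb-∈ : ∀ (A : Subspace) m a {g : Vector Vect m} → (∀ i → g i ∈ₛ A) → lincomb m a g ∈ₛ A
  lincomb-∈ A zero    a g∈A = 0∈ A
  lincomb-∈ A (suc m) a g∈A = +∈ A (·∈ A (head a) (g∈A zero)) (lincomb-∈ A m (tail a) (g∈A ∘ suc))

  Indep : (m : ℕ) → Vector Vect m → Set (c ⊔ ℓ)
  Indep m g = ∀ a → lincomb m a g ≈ᵥ 0ᵥ → ∀ i → a i ≈ 0#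

  Span : (m : ℕ) → Vector Vect m → Subspace
  Span m g = record
    { mem    = λ v → ∃ λ a → v ≈ᵥ lincomb m a g
    ; ∈-resp = λ u≈v (a , u≈) → a , λ j → trans (sym (u≈v j)) (u≈ j)
    ; 0∈     = (λ _ → 0#) , λ j → sym (lincomb-zero m g j)
    ; +∈     = λ (a , u≈) (a′ , v≈) → (λ i → a i + a′ i) ,
                 λ j → trans (+-cong (u≈ j) (v≈ j)) (sym (lincomb-+ m a a′ g j))
    ; ·∈     = λ k (a , v≈) → (λ i → k * a i) , λ j → trans (*-congˡ (v≈ j)) (sym (lincomb-· m k a g j))
    }

  span-⊆ : ∀ {m} {g : Vector Vect m} {A} → (∀ i → g i ∈ₛ A) → Span m g ⊆ A
  span-⊆ {m} {A = A} g∈A v (a , v≈) = ∈-resp A (λ j → sym (v≈ j)) (lincomb-∈ A m a g∈A)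

  infixl 23 _+⟨_⟩
  _+⟨_⟩ : Subspace → Vect → Subspace
  A +⟨ w ⟩ = record
    { mem    = λ v → Σ Vect λ u → Σ Carrier λ a → u ∈ₛ A × v ≈ᵥ u +ᵥ a · w
    ; ∈-resp = λ u≈v (u , a , u∈A , u≈) → u , a , u∈A , λ j → trans (sym (u≈v j)) (u≈ j)
    ; 0∈     = 0ᵥ , 0# , 0∈ A , λ j → sym (trans (+-identityˡ _) (zeroˡ (w j)))
    ; +∈     = λ (u , a , u∈A , v≈) (u′ , a′ , u′∈A , v′≈) → u +ᵥ u′ , a + a′ , +∈ A u∈A u′∈A ,
                 λ j → trans (+-cong (v≈ j) (v′≈ j))
                         (+*-distrib-+ (u j) a (u′ j) a′ (w j))
    ; ·∈     = λ k (u , a , u∈A , v≈) → k · u , k * a , ·∈ A k u∈A ,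
                 λ j → trans (*-congˡ (v≈ j))
                         (+*-distrib-* k (u j) a (w j))
    }

  ⊆-+⟨⟩ : ∀ {A w} → A ⊆ A +⟨ w ⟩
  ⊆-+⟨⟩ {w = w} v v∈A = v , 0# , v∈A , λ j → sym (trans (+-congˡ (zeroˡ (w j))) (+-identityʳ (v j)))

  ∈-+⟨⟩ : ∀ {A w} → w ∈ₛ A +⟨ w ⟩
  ∈-+⟨⟩ {A} {w} = 0ᵥ , 1# , 0∈ A , λ j → sym (trans (+-identityˡ _) (*-identityˡ (w j)))

  +⟨⟩-mono : ∀ {A B w} → A ⊆ B → A +⟨ w ⟩ ⊆ B +⟨ w ⟩
  +⟨⟩-mono A⊆B v (u , a , u∈A , v≈) = u , a , A⊆B u u∈A , v≈

  +⟨⟩-⊆ : ∀ {A B w} → A ⊆ B → w ∈ₛ B → A +⟨ w ⟩ ⊆ B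
  +⟨⟩-⊆ {B = B} A⊆B w∈B v (u , a , u∈A , v≈) =
    ∈-resp B (λ j → sym (v≈ j)) (+∈ B (A⊆B u u∈A) (·∈ B a w∈B))

  span-suc : ∀ {m} (g : Vector Vect (suc m)) → Span (suc m) g ≐ Span m (tail g) +⟨ head g ⟩
  span-suc {m} g = (λ v (a , v≈) → lincomb m (tail a) (tail g) , head a , (tail a , λ _ → refl) ,
                                    λ j → trans (v≈ j) (+-comm _ _))
                 , (λ v (u , a , (δ , u≈) , v≈) → a ∷ δ ,
                      λ j → trans (v≈ j) (trans (+-comm _ _) (+-congˡ (u≈ j))))

  ∈-span : ∀ {m} (g : Vector Vect m) i → g i ∈ₛ Span m g
  ∈-span {suc m} g zero    = proj₂ (span-suc g) _ (∈-+⟨⟩ {Span m (tail g)})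
  ∈-span {suc m} g (suc i) = proj₂ (span-suc g) _ (⊆-+⟨⟩ {Span m (tail g)} {head g} _ (∈-span (tail g) i))

  infixl 21 _+ₛ_
  _+ₛ_ : Subspace → Subspace → Subspace
  A +ₛ B = record
    { mem    = λ v → Σ Vect λ a → Σ Vect λ b → a ∈ₛ A × b ∈ₛ B × v ≈ᵥ a +ᵥ b
    ; ∈-resp = λ u≈v (a , b , a∈A , b∈B , u≈) → a , b , a∈A , b∈B , λ j → trans (sym (u≈v j)) (u≈ j)
    ; 0∈     = 0ᵥ , 0ᵥ , 0∈ A , 0∈ B , λ j → sym (+-identityˡ 0#)
    ; +∈     = λ (a , b , a∈A , b∈B , u≈) (a′ , b′ , a′∈A , b′∈B , v≈) →
                 a +ᵥ a′ , b +ᵥ b′ , +∈ A a∈A a′∈A , +∈ B b∈B b′∈B ,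
                 λ j → trans (+-cong (u≈ j) (v≈ j))
                         (+-interchange _ _ _ _)
    ; ·∈     = λ k (a , b , a∈A , b∈B , v≈) → k · a , k · b , ·∈ A k a∈A , ·∈ B k b∈B ,
                 λ j → trans (*-congˡ (v≈ j)) (distribˡ k _ _)
    }

  infixl 22 _∩ₛ_
  _∩ₛ_ : Subspace → Subspace → Subspace
  A ∩ₛ B = record
    { mem    = λ v → v ∈ₛ A × v ∈ₛ B
    ; ∈-resp = λ u≈v (u∈A , u∈B) → ∈-resp A u≈v u∈A , ∈-resp B u≈v u∈B
    ; 0∈     = 0∈ A , 0∈ B
    ; +∈     = λ (u∈A , u∈B) (v∈A , v∈B) → +∈ A u∈A v∈A , +∈ B u∈B v∈B
    ; ·∈     = λ k (v∈A , v∈B) → ·∈ A k v∈A , ·∈ B k v∈B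
    }

  ∈-+⁻ˡ : ∀ {A u v} → u +ᵥ v ∈ₛ A → v ∈ₛ A → u ∈ₛ A
  ∈-+⁻ˡ {A} {u} {v} u+v∈A v∈A = ∈-resp A u+v-v≈u (+∈ A u+v∈A (·∈ A (- 1#) v∈A))
    where
    u+v-v≈u : (u +ᵥ v) +ᵥ (- 1#) · v ≈ᵥ u
    u+v-v≈u j = trans (+-congʳ (+-congˡ (sym (*-identityˡ (v j))))) (+*-cancel (u j) (v j) (-‿inverseʳ 1#))

  ∈-+⁻ʳ : ∀ {A u v} → u +ᵥ v ∈ₛ A → u ∈ₛ A → v ∈ₛ A
  ∈-+⁻ʳ {A} u+v∈A = ∈-+⁻ˡ {A} (∈-resp A (λ j → +-comm _ _) u+v∈A)

  ⊆-∩-+⟨⟩ : ∀ {X A p} → p ∈ₛ X → X ⊆ A +⟨ p ⟩ → X ⊆ (X ∩ₛ A) +⟨ p ⟩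
  ⊆-∩-+⟨⟩ {X} p∈X X⊆A+p v v∈X with X⊆A+p v v∈X
  ... | u , β , u∈A , v≈ = u , β , (∈-+⁻ˡ {X} (∈-resp X v≈ v∈X) (·∈ X β p∈X) , u∈A) , v≈

  indep-tail : ∀ {m} (g : Vector Vect (suc m)) → Indep (suc m) g → Indep m (tail g)
  indep-tail g ind a la≈0 i = ind (0# ∷ a) (λ j → trans (*-vanishˡ refl) (la≈0 j)) (suc i)

  Decₛ : Subspace → Set (c ⊔ ℓ)
  Decₛ A = ∀ v → Dec (v ∈ₛ A)

  ∩? : ∀ {A B} → Decₛ A → Decₛ B → Decₛ (A ∩ₛ B)
  ∩? A? B? v = A? v ×-dec B? v

  hasDim-span : ∀ {m} {g : Vector Vect m} → Indep m g → HasDim (Span m g) m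
  hasDim-span {g = g} ind = g , ∈-span g , ind , λ _ → id

  infixl 23 _+⟨_⟩*
  _+⟨_⟩* : Subspace → ∀ {k} → Vector Vect k → Subspace
  _+⟨_⟩* A {zero}  h = A
  _+⟨_⟩* A {suc k} h = (A +⟨ head h ⟩) +⟨ tail h ⟩*

  +⟨⟩*-contains : ∀ {A} k (h : Vector Vect k) a {u} → u ∈ₛ A → u +ᵥ lincomb k a h ∈ₛ A +⟨ h ⟩*
  +⟨⟩*-contains {A} zero    h a u∈A = ∈-resp A (λ j → sym (+-identityʳ _)) u∈A
  +⟨⟩*-contains {A} (suc k) h a u∈A =
    ∈-resp (A +⟨ h ⟩*) (λ j → +-assoc _ _ _)
      (+⟨⟩*-contains k (tail h) (tail a) (_ , head a , u∈A , λ _ → refl))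

  span⊆+⟨⟩* : ∀ {A k} (h : Vector Vect k) → Span k h ⊆ A +⟨ h ⟩*
  span⊆+⟨⟩* {A} {k} h v (a , v≈) =
    ∈-resp (A +⟨ h ⟩*) (λ j → trans (+-identityˡ _) (sym (v≈ j))) (+⟨⟩*-contains k h a (0∈ A))

  FlipPoint : ∀ {p r} → (Subspace → Set p) → (Subspace → Set r) → ∀ {k} → Vector Vect k
            → Set (lsuc (c ⊔ ℓ) ⊔ p ⊔ r)
  FlipPoint P Q {k} h = Σ Subspace λ V → Σ (Fin k) λ i → P V × ¬ Q V × Q (V +⟨ h i ⟩)

  first-flip : ∀ {p r} (P : Subspace → Set p) (Q : Subspace → Set r) → (∀ A → Dec (Q A))
    → ∀ {k} (h : Vector Vect k) → (∀ {A} i → P A → P (A +⟨ h i ⟩))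
    → ∀ {A} → P A → ¬ Q A → Q (A +⟨ h ⟩*) → FlipPoint P Q h
  first-flip P Q Q? {zero}  h P-step PA ¬QA QA+h = ⊥-elim (¬QA QA+h)
  first-flip P Q Q? {suc k} h P-step {A} PA ¬QA QA+h = flip-here? (Q? (A +⟨ head h ⟩))
    where
    flip-here? : Dec (Q (A +⟨ head h ⟩)) → FlipPoint P Q h
    flip-here? (yes QA+h₀) = A , zero , PA , ¬QA , QA+h₀
    flip-here? (no ¬QA+h₀) = shift (first-flip P Q Q? (tail h) (P-step ∘ suc) (P-step zero PA) ¬QA+h₀ QA+h)
      where
      shift : FlipPoint P Q (tail h) → FlipPoint P Q h
      shift (V , i , flip) = V , suc i , flip

module Space {c ℓ : Level} (R : CommutativeRing c ℓ) (isField : IsField R)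
             {q : ℕ} (card : HasCardinality R q) (n : ℕ) where
  open CommutativeRing R hiding (zero)
  open IsField isField
  open FiniteField R card
  open HasCardinality card using (enum; surjective)
  open Linear R n
  open Subspaces R n
  open Subspace using (∈-resp; 0∈; +∈; ·∈)

  ∈-·⁻ : ∀ {A a w} → ¬ a ≈ 0# → a · w ∈ₛ A → w ∈ₛ A
  ∈-·⁻ {A} {a} {w} a≉0 aw∈A with inverse a a≉0
  ... | a⁻¹ , a*a⁻¹≈1 = ∈-resp A a⁻¹aw≈w (·∈ A a⁻¹ aw∈A)
    where
    a⁻¹aw≈w : a⁻¹ · (a · w) ≈ᵥ w
    a⁻¹aw≈w j = begin
      a⁻¹ * (a * w j)  ≈⟨ *-assoc a⁻¹ a (w j) ⟨
      (a⁻¹ * a) * w j  ≈⟨ *-congʳ (*-comm a⁻¹ a) ⟩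
      (a * a⁻¹) * w j  ≈⟨ *-congʳ a*a⁻¹≈1 ⟩
      1# * w j         ≈⟨ *-identityˡ (w j) ⟩
      w j              ∎
      where open SetoidReasoning setoid

  +⟨⟩-∩ : ∀ {A X w v} → ¬ w ∈ₛ A → X ⊆ A → v ∈ₛ A → v ∈ₛ X +⟨ w ⟩ → v ∈ₛ X
  +⟨⟩-∩ {A} {X} w∉A X⊆A v∈A (u , a , u∈X , v≈) with a ≟ 0#
  ... | yes a≈0 = ∈-resp X (λ j → sym (trans (v≈ j) (*-vanishʳ a≈0))) u∈X
  ... | no  a≉0 = ⊥-elim (w∉A (∈-·⁻ {A} a≉0 (∈-+⁻ʳ {A} (∈-resp A v≈ v∈A) (X⊆A u u∈X))))

  line-∩ : ∀ {A w} → ¬ w ∈ₛ A → ∀ v → v ∈ₛ A → (Σ Carrier λ a → v ≈ᵥ a · w) → v ≈ᵥ 0ᵥ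
  line-∩ {A} {w} w∉A v v∈A (a , v≈) with a ≟ 0#
  ... | yes a≈0 = λ j → trans (v≈ j) (trans (*-congʳ a≈0) (zeroˡ (w j)))
  ... | no  a≉0 = ⊥-elim (w∉A (∈-·⁻ {A} a≉0 (∈-resp A v≈ v∈A)))

  +⟨⟩-exchange : ∀ {A x w} → w ∈ₛ A +⟨ x ⟩ → ¬ w ∈ₛ A → A +⟨ x ⟩ ⊆ A +⟨ w ⟩
  +⟨⟩-exchange {A} {x} {w} (t , γ , t∈A , w≈) w∉A with γ ≟ 0#
  ... | yes γ≈0 = ⊥-elim (w∉A (∈-resp A (λ j → sym (trans (w≈ j) (*-vanishʳ γ≈0))) t∈A))
  ... | no  γ≉0 = +⟨⟩-⊆ {A} {A +⟨ w ⟩} {x} (⊆-+⟨⟩ {A} {w}) x∈A+w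
    where
    x∈A+w : x ∈ₛ A +⟨ w ⟩
    x∈A+w = ∈-·⁻ {A +⟨ w ⟩} γ≉0 (∈-+⁻ʳ {A +⟨ w ⟩} (∈-resp (A +⟨ w ⟩) w≈ (∈-+⟨⟩ {A})) (⊆-+⟨⟩ {A} {w} t t∈A))

  head∉span-tail : ∀ {m} (g : Vector Vect (suc m)) → Indep (suc m) g → ¬ head g ∈ₛ Span m (tail g)
  head∉span-tail {m} g ind (a , g₀≈) = 1≉0 (-‿injective (trans -1≈0 (sym -0#≈0#)))
    where
    open import Algebra.Properties.Ring ring using (-1*x≈-x; -‿injective; -0#≈0#)
    -1≈0 : - 1# ≈ 0#
    -1≈0 = ind (- 1# ∷ a) (λ j → trans (+-congʳ (trans (*-congˡ (g₀≈ j)) (-1*x≈-x _))) (-‿inverseˡ _)) zero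

  indep-suc : ∀ {m} (g : Vector Vect (suc m)) → ¬ head g ∈ₛ Span m (tail g) → Indep m (tail g)
            → Indep (suc m) g
  indep-suc {m} g g₀∉ ind a la≈0 with head a ≟ 0#
  ... | yes a₀≈0 = λ { zero    → a₀≈0
                     ; (suc i) → ind (tail a) (λ j → trans (sym (*-vanishˡ a₀≈0)) (la≈0 j)) i }
  ... | no  a₀≉0 =
    ⊥-elim (g₀∉ (∈-·⁻ {S} a₀≉0 (∈-+⁻ˡ {S} (∈-resp S (λ j → sym (la≈0 j)) (0∈ S)) (tail a , λ _ → refl))))
    where
    S : Subspace
    S = Span m (tail g)

  infix 4 _≟ᵥ_
  _≟ᵥ_ : Decidable _≈ᵥ_
  u ≟ᵥ v = FinP.all? (λ i → u i ≟ v i)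

  span? : ∀ {m} (g : Vector Vect m) → Decₛ (Span m g)
  span? {m} g v = ∃-coefficients? m (λ a → v ≈ᵥ lincomb m a g)
                    (λ a≈a′ v≈ j → trans (v≈ j) (lincomb-cong m g a≈a′ j)) (λ a → v ≟ᵥ lincomb m a g)

  +⟨⟩? : ∀ {A} w → Decₛ A → Decₛ (A +⟨ w ⟩)
  +⟨⟩? {A} w A? v = map′ to from (FinP.any? λ i → A? (v +ᵥ (- enum i) · w))
    where
    to : ∃ (λ i → v +ᵥ (- enum i) · w ∈ₛ A) → v ∈ₛ A +⟨ w ⟩
    to (i , p) = _ , enum i , p , λ j → sym (+*-cancel (v j) (w j) (-‿inverseˡ (enum i)))

    from : v ∈ₛ A +⟨ w ⟩ → ∃ (λ i → v +ᵥ (- enum i) · w ∈ₛ A)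
    from (u , a , u∈A , v≈) with surjective a
    ... | i , enumᵢ≈a = i , ∈-resp A (λ j → sym (trans (+-cong (v≈ j) (*-congʳ (-‿cong enumᵢ≈a)))
                                                       (+*-cancel (u j) (w j) (-‿inverseʳ a)))) u∈A

  ⊆-or-escapes : ∀ {m} {g : Vector Vect m} {X A} → Decₛ X → Decₛ A → X ⊆ Span m g
               → (Σ Vect λ p → p ∈ₛ X × ¬ p ∈ₛ A) ⊎ X ⊆ A
  ⊆-or-escapes {m} {g} {X} {A} X? A? X⊆S =
    conclude (∃-coefficients? m Escapes resp (λ a → X? _ ×-dec ¬? (A? _)))
    where
    Escapes : Vector Carrier m → Set (c ⊔ ℓ)
    Escapes a = lincomb m a g ∈ₛ X × ¬ lincomb m a g ∈ₛ A

    resp : ∀ {a a′} → (∀ i → a i ≈ a′ i) → Escapes a → Escapes a′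
    resp a≈a′ (∈X , ∉A) = ∈-resp X (lincomb-cong m g a≈a′) ∈X ,
                          ∉A ∘ ∈-resp A (λ j → sym (lincomb-cong m g a≈a′ j))

    conclude : Dec (∃ Escapes) → (Σ Vect λ p → p ∈ₛ X × ¬ p ∈ₛ A) ⊎ X ⊆ A
    conclude (yes (a , escapes)) = inj₁ (_ , escapes)
    conclude (no ¬escapes)       = inj₂ λ v v∈X → decidable-stable (A? v) λ v∉A →
      let a , v≈ = X⊆S v v∈X in ¬escapes (a , ∈-resp X v≈ v∈X , v∉A ∘ ∈-resp A (λ j → sym (v≈ j)))

  hasDim⇒dec : ∀ {A d} → HasDim A d → Decₛ A
  hasDim⇒dec {A} (b , b∈A , _ , A⊆) v = map′ (span-⊆ {A = A} b∈A v) (A⊆ v) (span? b v)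

  hasDim-+⟨⟩ : ∀ {A d w} → HasDim A d → ¬ w ∈ₛ A → HasDim (A +⟨ w ⟩) (suc d)
  hasDim-+⟨⟩ {A} {d} {w} (b , b∈A , ind , A⊆) w∉A =
    w ∷ b , ∈-A+w , indep-suc (w ∷ b) (w∉A ∘ span-⊆ {A = A} b∈A w) ind ,
    λ v → proj₂ (span-suc (w ∷ b)) v ∘ +⟨⟩-mono {A} {Span d b} {w} A⊆ v
    where
    ∈-A+w : ∀ i → (w ∷ b) i ∈ₛ A +⟨ w ⟩
    ∈-A+w zero    = ∈-+⟨⟩ {A}
    ∈-A+w (suc i) = ⊆-+⟨⟩ {A} (b i) (b∈A i)

  record SeparatingHyperplane (S : Subspace) (m : ℕ) (X : Subspace) (x : Vect) : Set (c ⊔ ℓ) where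
    field
      k       : ℕ
      m≡1+k   : m ≡ suc k
      basis   : Vector Vect k
      indep   : Indep k basis
      basis∈S : ∀ i → basis i ∈ₛ S
      X⊆H     : X ⊆ Span k basis
      x∉H     : ¬ x ∈ₛ Span k basis
      S⊆H+x   : S ⊆ Span k basis +⟨ x ⟩

    H : Subspace
    H = Span k basis

    H⊆S : H ⊆ S
    H⊆S = span-⊆ {A = S} basis∈S

  -- Write x = x′ + γ p with x′ ∈ S′, and extend a hyperplane of S′ through X ∩ S′ that
  -- misses x′ by the vector p.
  hyperplane-extend : ∀ {S S′ X x p m} → S′ ⊆ S → p ∈ₛ S → ¬ p ∈ₛ S′ → S ⊆ S′ +⟨ p ⟩
    → X ⊆ (X ∩ₛ S′) +⟨ p ⟩ → x ∈ₛ S → ¬ x ∈ₛ X +⟨ p ⟩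
    → (∀ {x′} → x′ ∈ₛ S′ → ¬ x′ ∈ₛ X ∩ₛ S′ → SeparatingHyperplane S′ m (X ∩ₛ S′) x′)
    → SeparatingHyperplane S (suc m) X x
  hyperplane-extend {S} {S′} {X} {x} {p} S′⊆S p∈S p∉S′ S⊆S′+p X⊆ x∈S x∉X+p hyperplane
    with S⊆S′+p x x∈S
  ... | x′ , γ , x′∈S′ , x≈ = record
    { k       = suc k
    ; m≡1+k   = ≡.cong suc m≡1+k
    ; basis   = p ∷ basis
    ; indep   = indep-suc (p ∷ basis) (p∉S′ ∘ H⊆S p) indep
    ; basis∈S = λ { zero → p∈S ; (suc i) → S′⊆S _ (basis∈S i) }
    ; X⊆H     = λ v → H+p⊆Hₚ v ∘ +⟨⟩-mono {X ∩ₛ S′} {H} {p} X⊆H v ∘ X⊆ v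
    ; x∉H     = x∉H ∘ +⟨⟩-∩ {S′} {H} p∉S′ H⊆S x′∈S′ ∘ x′∈H+p ∘ Hₚ⊆H+p x
    ; S⊆H+x   = λ v → +⟨⟩-⊆ {S′} {Hₚ +⟨ x ⟩} S′⊆Hₚ+x (⊆-+⟨⟩ {Hₚ} p p∈Hₚ) v ∘ S⊆S′+p v
    }
    where
    x′∉X∩S′ : ¬ x′ ∈ₛ X ∩ₛ S′
    x′∉X∩S′ (x′∈X , _) = x∉X+p (x′ , γ , x′∈X , x≈)

    open SeparatingHyperplane (hyperplane x′∈S′ x′∉X∩S′)

    Hₚ : Subspace
    Hₚ = Span (suc k) (p ∷ basis)

    Hₚ⊆H+p : Hₚ ⊆ H +⟨ p ⟩
    Hₚ⊆H+p = proj₁ (span-suc (p ∷ basis))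

    H+p⊆Hₚ : H +⟨ p ⟩ ⊆ Hₚ
    H+p⊆Hₚ = proj₂ (span-suc (p ∷ basis))

    H⊆Hₚ : H ⊆ Hₚ
    H⊆Hₚ v = H+p⊆Hₚ v ∘ ⊆-+⟨⟩ {H} {p} v

    p∈Hₚ : p ∈ₛ Hₚ
    p∈Hₚ = ∈-span (p ∷ basis) zero

    x′∈H+p : x ∈ₛ H +⟨ p ⟩ → x′ ∈ₛ H +⟨ p ⟩
    x′∈H+p x∈ = ∈-+⁻ˡ {H +⟨ p ⟩} (∈-resp (H +⟨ p ⟩) x≈ x∈) (·∈ (H +⟨ p ⟩) γ (∈-+⟨⟩ {H}))

    x′∈Hₚ+x : x′ ∈ₛ Hₚ +⟨ x ⟩
    x′∈Hₚ+x = ∈-+⁻ˡ {Hₚ +⟨ x ⟩} (∈-resp (Hₚ +⟨ x ⟩) x≈ (∈-+⟨⟩ {Hₚ})) (·∈ (Hₚ +⟨ x ⟩) γ (⊆-+⟨⟩ {Hₚ} p p∈Hₚ))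

    S′⊆Hₚ+x : S′ ⊆ Hₚ +⟨ x ⟩
    S′⊆Hₚ+x v = +⟨⟩-⊆ {H} {Hₚ +⟨ x ⟩} (λ u → ⊆-+⟨⟩ {Hₚ} {x} u ∘ H⊆Hₚ u) x′∈Hₚ+x v ∘ S⊆H+x v

  -- With S′ = span (tail g): extend along a vector of X outside S′ if there is one, and
  -- otherwise along head g, unless x ∉ S′, in which case S′ itself separates.
  separating-hyperplane-span : ∀ m {g : Vector Vect m} {X x} → Indep m g → Decₛ X → X ⊆ Span m g
    → x ∈ₛ Span m g → ¬ x ∈ₛ X → SeparatingHyperplane (Span m g) m X x
  separating-hyperplane-span zero {X = X} _ _ _ (_ , x≈0) x∉X =
    ⊥-elim (x∉X (∈-resp X (λ j → sym (x≈0 j)) (0∈ X)))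
  separating-hyperplane-span (suc m) {g} {X} {x} ind X? X⊆S x∈S x∉X =
    cases (⊆-or-escapes {g = g} {X} {S′} X? (span? (tail g)) X⊆S) (span? (tail g) x)
    where
    S′ : Subspace
    S′ = Span m (tail g)

    S′⊆S : S′ ⊆ Span (suc m) g
    S′⊆S v = proj₂ (span-suc g) v ∘ ⊆-+⟨⟩ {S′} {head g} v

    S⊆S′+g₀ : Span (suc m) g ⊆ S′ +⟨ head g ⟩
    S⊆S′+g₀ = proj₁ (span-suc g)

    g₀∉S′ : ¬ head g ∈ₛ S′
    g₀∉S′ = head∉span-tail g ind

    hyperplane : ∀ {x′} → x′ ∈ₛ S′ → ¬ x′ ∈ₛ X ∩ₛ S′ → SeparatingHyperplane S′ m (X ∩ₛ S′) x′
    hyperplane = separating-hyperplane-span m (indep-tail g ind) (∩? {X} {S′} X? (span? (tail g)))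
                   (λ _ → proj₂)

    cases : (Σ Vect λ p → p ∈ₛ X × ¬ p ∈ₛ S′) ⊎ X ⊆ S′ → Dec (x ∈ₛ S′)
          → SeparatingHyperplane (Span (suc m) g) (suc m) X x
    cases (inj₁ (p , p∈X , p∉S′)) _ =
      hyperplane-extend S′⊆S p∈S p∉S′ S⊆S′+p (⊆-∩-+⟨⟩ {X} {S′} {p} p∈X (λ v → S⊆S′+p v ∘ X⊆S v))
        x∈S (x∉X ∘ +⟨⟩-⊆ {X} {X} (λ _ → id) p∈X x) hyperplane
      where
      p∈S : p ∈ₛ Span (suc m) g
      p∈S = X⊆S p p∈X

      S⊆S′+p : Span (suc m) g ⊆ S′ +⟨ p ⟩
      S⊆S′+p v = +⟨⟩-exchange {S′} (S⊆S′+g₀ p p∈S) p∉S′ v ∘ S⊆S′+g₀ v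
    cases (inj₂ X⊆S′) (yes x∈S′) =
      hyperplane-extend S′⊆S (∈-span g zero) g₀∉S′ S⊆S′+g₀ (λ v v∈X → ⊆-+⟨⟩ {X ∩ₛ S′} v (v∈X , X⊆S′ v v∈X))
        x∈S (x∉X ∘ +⟨⟩-∩ {S′} {X} g₀∉S′ X⊆S′ x∈S′) hyperplane
    cases (inj₂ X⊆S′) (no x∉S′) = record
      { k       = m
      ; m≡1+k   = ≡.refl
      ; basis   = tail g
      ; indep   = indep-tail g ind
      ; basis∈S = ∈-span g ∘ suc
      ; X⊆H     = X⊆S′
      ; x∉H     = x∉S′
      ; S⊆H+x   = λ v → +⟨⟩-exchange {S′} (S⊆S′+g₀ x x∈S) x∉S′ v ∘ S⊆S′+g₀ v
      }

  separating-hyperplane : ∀ {S m X x} → HasDim S m → Decₛ X → X ⊆ S → x ∈ₛ S → ¬ x ∈ₛ X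
                        → SeparatingHyperplane S m X x
  separating-hyperplane {S} {m} {X} {x} (b , b∈S , ind , S⊆B) X? X⊆S x∈S x∉X = record
    { k       = k
    ; m≡1+k   = m≡1+k
    ; basis   = basis
    ; indep   = indep
    ; basis∈S = λ i → span-⊆ {A = S} b∈S _ (basis∈S i)
    ; X⊆H     = X⊆H
    ; x∉H     = x∉H
    ; S⊆H+x   = λ v → S⊆H+x v ∘ S⊆B v
    }
    where
    open SeparatingHyperplane
      (separating-hyperplane-span m {b} {X} {x} ind X? (λ v → S⊆B v ∘ X⊆S v) (S⊆B x x∈S) x∉X)

  isDirectSumLine : ∀ {S U w} → S ≐ U +⟨ w ⟩ → ¬ w ∈ₛ U → IsDirectSumLine S U w
  isDirectSumLine {U = U} (S⊆U+w , U+w⊆S) w∉U = (λ v → S⊆U+w v , U+w⊆S v) , line-∩ {U} w∉U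

  module Rank (ρ : Subspace → ℕ) (isQMatroid : IsQMatroid ρ) where
    open IsQMatroid isQMatroid

    submodular : ∀ A B → ρ (A +ₛ B) +ℕ ρ (A ∩ₛ B) ≤ ρ A +ℕ ρ B
    submodular A B = r3 A B (A +ₛ B) (A ∩ₛ B) (λ _ → id , id) (λ _ → id , id)

    InClosure : Subspace → Vect → Set
    InClosure A v = ρ (A +⟨ v ⟩) ≤ ρ A

    closure? : ∀ v A → Dec (InClosure A v)
    closure? v A = ρ (A +⟨ v ⟩) ℕP.≤? ρ A

    ∈⇒InClosure : ∀ {A v} → v ∈ₛ A → InClosure A v
    ∈⇒InClosure {A} v∈A = r2 _ _ (+⟨⟩-⊆ {A} {A} (λ _ → id) v∈A)

    ρ-+⟨⟩ : ∀ A w → ρ (A +⟨ w ⟩) ≤ suc (ρ A)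
    ρ-+⟨⟩ A w with w ≟ᵥ 0ᵥ
    ... | yes w≈0 = ℕP.m≤n⇒m≤1+n (∈⇒InClosure {A} (∈-resp A (λ j → sym (w≈0 j)) (0∈ A)))
    ... | no  w≉0 = begin
      ρ (A +⟨ w ⟩)              ≤⟨ r2 _ _ A+w⊆A+L ⟩
      ρ (A +ₛ L)                ≤⟨ ℕP.m≤m+n _ _ ⟩
      ρ (A +ₛ L) +ℕ ρ (A ∩ₛ L)  ≤⟨ submodular A L ⟩
      ρ A +ℕ ρ L                ≤⟨ ℕP.+-monoʳ-≤ (ρ A) (r1 L 1 (hasDim-span {g = λ _ → w} line-indep)) ⟩
      ρ A +ℕ 1                  ≡⟨ ℕP.+-comm (ρ A) 1 ⟩
      suc (ρ A)                 ∎
      where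
      open ℕP.≤-Reasoning
      L : Subspace
      L = Span 1 (λ _ → w)
      line-indep : Indep 1 (λ _ → w)
      line-indep = indep-suc (λ _ → w) (λ (_ , w≈0) → w≉0 w≈0) (λ _ _ ())
      A+w⊆A+L : A +⟨ w ⟩ ⊆ A +ₛ L
      A+w⊆A+L v (u , a , u∈A , v≈) = u , a · w , u∈A , ·∈ L a (∈-span (λ _ → w) zero) , v≈

    closure-mono : ∀ {A B v} → A ⊆ B → InClosure A v → InClosure B v
    closure-mono {A} {B} {v} A⊆B A+v≤A = ℕP.+-cancelʳ-≤ (ρ A) (ρ (B +⟨ v ⟩)) (ρ B) (begin
      ρ (B +⟨ v ⟩) +ℕ ρ A                          ≤⟨ ℕP.+-mono-≤ (r2 _ _ B+v⊆) (r2 _ _ A⊆∩) ⟩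
      ρ (A +⟨ v ⟩ +ₛ B) +ℕ ρ (A +⟨ v ⟩ ∩ₛ B)      ≤⟨ submodular (A +⟨ v ⟩) B ⟩
      ρ (A +⟨ v ⟩) +ℕ ρ B                          ≤⟨ ℕP.+-monoˡ-≤ (ρ B) A+v≤A ⟩
      ρ A +ℕ ρ B                                   ≡⟨ ℕP.+-comm (ρ A) (ρ B) ⟩
      ρ B +ℕ ρ A                                   ∎)
      where
      open ℕP.≤-Reasoning
      B+v⊆ : B +⟨ v ⟩ ⊆ A +⟨ v ⟩ +ₛ B
      B+v⊆ u (b , a , b∈B , u≈) =
        a · v , b , ·∈ (A +⟨ v ⟩) a (∈-+⟨⟩ {A}) , b∈B , λ j → trans (u≈ j) (+-comm _ _)
      A⊆∩ : A ⊆ A +⟨ v ⟩ ∩ₛ B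
      A⊆∩ u u∈A = ⊆-+⟨⟩ {A} {v} u u∈A , A⊆B u u∈A

    closure-exchange : ∀ {U V x y} → V ⊆ U → ¬ InClosure V y → InClosure (V +⟨ x ⟩) y → InClosure U y
                     → InClosure U x
    closure-exchange {U} {V} {x} {y} V⊆U y∉clV y∈clV+x y∈clU =
      ℕP.+-cancelʳ-≤ (suc (ρ V)) (ρ (U +⟨ x ⟩)) (ρ U) (begin
        ρ (U +⟨ x ⟩) +ℕ suc (ρ V)   ≤⟨ ℕP.+-mono-≤ (r2 _ _ U+x⊆A+B)
                                                    (ℕP.≤-trans (ℕP.≰⇒> y∉clV) (r2 _ _ V+y⊆A∩B)) ⟩
        ρ (A +ₛ B) +ℕ ρ (A ∩ₛ B)   ≤⟨ submodular A B ⟩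
        ρ A +ℕ ρ B                 ≤⟨ ℕP.+-mono-≤ y∈clU (ℕP.≤-trans y∈clV+x (ρ-+⟨⟩ V x)) ⟩
        ρ U +ℕ suc (ρ V)           ∎)
      where
      open ℕP.≤-Reasoning
      A B : Subspace
      A = U +⟨ y ⟩
      B = V +⟨ x ⟩ +⟨ y ⟩
      U+x⊆A+B : U +⟨ x ⟩ ⊆ A +ₛ B
      U+x⊆A+B v (u , a , u∈U , v≈) =
        u , a · x , ⊆-+⟨⟩ {U} {y} u u∈U , ·∈ B a (⊆-+⟨⟩ {V +⟨ x ⟩} {y} x (∈-+⟨⟩ {V})) , v≈
      V+y⊆A∩B : V +⟨ y ⟩ ⊆ A ∩ₛ B
      V+y⊆A∩B v v∈ = +⟨⟩-mono {V} {U} {y} V⊆U v v∈ , +⟨⟩-mono {V} {V +⟨ x ⟩} {y} (⊆-+⟨⟩ {V} {x}) v v∈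

    basis-closure : ∀ {B A v} → ρ B ≡ ρ full → B ⊆ A → InClosure A v
    basis-closure {B} {A} {v} ρB≡ρE B⊆A = begin
      ρ (A +⟨ v ⟩)  ≤⟨ r2 _ full (λ _ _ → _) ⟩
      ρ full        ≡⟨ ≡.sym ρB≡ρE ⟩
      ρ B           ≤⟨ r2 _ _ B⊆A ⟩
      ρ A           ∎
      where open ℕP.≤-Reasoning

    independent-+⟨⟩ : ∀ {U y} → Independent ρ U → ¬ InClosure U y → Independent ρ (U +⟨ y ⟩)
    independent-+⟨⟩ {U} {y} (d , dim , ρU≡d) y∉clU =
      suc d , dim+ , ℕP.≤-antisym (r1 _ _ dim+) (≡.subst (λ r → suc r ≤ ρ (U +⟨ y ⟩)) ρU≡d (ℕP.≰⇒> y∉clU))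
      where
      dim+ : HasDim (U +⟨ y ⟩) (suc d)
      dim+ = hasDim-+⟨⟩ {U} dim (y∉clU ∘ ∈⇒InClosure {U})

    hyperplane-rank : ∀ {S m X x} → ρ S ≡ m → (Hyp : SeparatingHyperplane S m X x)
                    → let open SeparatingHyperplane Hyp in ρ H ≡ k × ¬ InClosure H x
    hyperplane-rank {S} {m} {X} {x} ρS≡m Hyp =
      ℕP.≤-antisym ρH≤k (ℕP.≤-pred (ℕP.≤-trans 1+k≤ρH+x (ρ-+⟨⟩ H x))) ,
      λ x∈clH → ℕP.<⇒≱ (ℕP.≤-trans 1+k≤ρH+x x∈clH) ρH≤k
      where
      open SeparatingHyperplane Hyp
      ρH≤k : ρ H ≤ k
      ρH≤k = r1 H k (hasDim-span indep)
      1+k≤ρH+x : suc k ≤ ρ (H +⟨ x ⟩)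
      1+k≤ρH+x = ≡.subst (_≤ ρ (H +⟨ x ⟩)) (≡.trans ρS≡m m≡1+k) (r2 _ _ S⊆H+x)

    flip-point : ∀ {B₁ B₂ y} → IsBasis ρ B₁ → IsBasis ρ B₂ → y ∈ₛ B₂ → ¬ y ∈ₛ B₁
      → Σ Subspace λ V → Σ Vect λ x → B₁ ∩ₛ B₂ ⊆ V × V ⊆ B₁ × Decₛ V × x ∈ₛ B₁
                                     × ¬ InClosure V y × InClosure (V +⟨ x ⟩) y
    flip-point {B₁} {B₂} {y} ((d₁ , dim₁ , _) , ρB₁≡ρE) ((d₂ , dim₂ , ρB₂≡d₂) , _) y∈B₂ y∉B₁
      = flip-at-basis-vector
          (first-flip Between (λ A → InClosure A y) (closure? y) b (λ {A} → Between-step {A})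
                      Between-I y∉clI y∈clI+b)
      where
      I : Subspace
      I = B₁ ∩ₛ B₂
      I? : Decₛ I
      I? = ∩? {B₁} {B₂} (hasDim⇒dec {B₁} dim₁) (hasDim⇒dec {B₂} dim₂)

      y∉clI : ¬ InClosure I y
      y∉clI = proj₂ (hyperplane-rank ρB₂≡d₂ Y) ∘ closure-mono {I} X⊆H
        where
        Y : SeparatingHyperplane B₂ d₂ I y
        Y = separating-hyperplane {B₂} {d₂} {I} {y} dim₂ I? (λ _ → proj₂) y∈B₂ (y∉B₁ ∘ proj₁)
        open SeparatingHyperplane Y

      b : Vector Vect d₁
      b = proj₁ dim₁

      b∈B₁ : ∀ i → b i ∈ₛ B₁
      b∈B₁ = proj₁ (proj₂ dim₁)

      B₁⊆span-b : B₁ ⊆ Span d₁ b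
      B₁⊆span-b = proj₂ (proj₂ (proj₂ dim₁))

      y∈clI+b : InClosure (I +⟨ b ⟩*) y
      y∈clI+b = basis-closure {B₁} ρB₁≡ρE (λ v → span⊆+⟨⟩* {I} b v ∘ B₁⊆span-b v)

      Between : Subspace → Set (c ⊔ ℓ)
      Between A = I ⊆ A × A ⊆ B₁ × Decₛ A

      Between-I : Between I
      Between-I = (λ _ → id) , (λ _ → proj₁) , I?

      Between-step : ∀ {A} i → Between A → Between (A +⟨ b i ⟩)
      Between-step {A} i (I⊆A , A⊆B₁ , A?) =
        (λ v → ⊆-+⟨⟩ {A} {b i} v ∘ I⊆A v) , +⟨⟩-⊆ {A} {B₁} A⊆B₁ (b∈B₁ i) , +⟨⟩? {A} (b i) A?

      flip-at-basis-vector : FlipPoint Between (λ A → InClosure A y) b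
        → Σ Subspace λ V → Σ Vect λ x → I ⊆ V × V ⊆ B₁ × Decₛ V × x ∈ₛ B₁
                                       × ¬ InClosure V y × InClosure (V +⟨ x ⟩) y
      flip-at-basis-vector (V , i , (I⊆V , V⊆B₁ , V?) , y∉clV , y∈clV+bᵢ) =
        V , b i , I⊆V , V⊆B₁ , V? , b∈B₁ i , y∉clV , y∈clV+bᵢ

    exchange-at-flip : ∀ {B V x y} → IsBasis ρ B → V ⊆ B → Decₛ V → x ∈ₛ B
      → ¬ InClosure V y → InClosure (V +⟨ x ⟩) y
      → Σ Subspace λ U → V ⊆ U × ¬ x ∈ₛ U × B ≐ U +⟨ x ⟩ × IsBasis ρ (U +⟨ y ⟩)
    exchange-at-flip {B} {V} {x} {y} ((d , dim , ρB≡d) , ρB≡ρE) V⊆B V? x∈B y∉clV y∈clV+x =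
      H , X⊆H , x∉H , (S⊆H+x , +⟨⟩-⊆ {H} {B} H⊆S x∈B) , (W-independent , ρW≡ρE)
      where
      x∉V : ¬ x ∈ₛ V
      x∉V x∈V = y∉clV (closure-mono (+⟨⟩-⊆ {V} {V} (λ _ → id) x∈V) y∈clV+x)

      Hyp : SeparatingHyperplane B d V x
      Hyp = separating-hyperplane dim V? V⊆B x∈B x∉V
      open SeparatingHyperplane Hyp

      y∉clH : ¬ InClosure H y
      y∉clH = proj₂ (hyperplane-rank ρB≡d Hyp) ∘ closure-exchange X⊆H y∉clV y∈clV+x

      W-independent : Independent ρ (H +⟨ y ⟩)
      W-independent = independent-+⟨⟩ (k , hasDim-span indep , proj₁ (hyperplane-rank ρB≡d Hyp)) y∉clH

      ρW≡ρE : ρ (H +⟨ y ⟩) ≡ ρ full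
      ρW≡ρE = begin
        ρ (H +⟨ y ⟩)  ≡⟨ proj₂ (proj₂ W-independent) ⟩
        suc k         ≡⟨ ≡.sym m≡1+k ⟩
        d             ≡⟨ ≡.sym ρB≡d ⟩
        ρ B           ≡⟨ ρB≡ρE ⟩
        ρ full        ∎
        where open ≡.≡-Reasoning

    q-basis-exchange : ∀ {B₁ B₂ y} → IsBasis ρ B₁ → IsBasis ρ B₂ → y ∈ₛ B₂ → ¬ y ∈ₛ B₁
      → Σ Subspace λ U → Σ Vect λ x →
          x ∈ₛ B₁ × ¬ x ∈ₛ B₂
        × (∀ v → v ∈ₛ B₁ → v ∈ₛ B₂ → v ∈ₛ U)
        × IsDirectSumLine B₁ U x
        × Σ Subspace λ W → IsDirectSumLine W U y × IsBasis ρ W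
    q-basis-exchange {B₁} {B₂} {y} B₁-basis B₂-basis y∈B₂ y∉B₁ =
      let V , x , I⊆V , V⊆B₁ , V? , x∈B₁ , y∉clV , y∈clV+x = flip-point B₁-basis B₂-basis y∈B₂ y∉B₁
          U , V⊆U , x∉U , B₁≐U+x , W-basis = exchange-at-flip B₁-basis V⊆B₁ V? x∈B₁ y∉clV y∈clV+x
          I⊆U : B₁ ∩ₛ B₂ ⊆ U
          I⊆U v = V⊆U v ∘ I⊆V v
          y∉U : ¬ y ∈ₛ U
          y∉U = y∉B₁ ∘ proj₂ B₁≐U+x y ∘ ⊆-+⟨⟩ {U} {x} y
      in U , x , x∈B₁ , x∉U ∘ I⊆U x ∘ (x∈B₁ ,_) , (λ v v∈B₁ v∈B₂ → I⊆U v (v∈B₁ , v∈B₂)) ,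
         isDirectSumLine {B₁} {U} B₁≐U+x x∉U ,
         U +⟨ y ⟩ , isDirectSumLine {U +⟨ y ⟩} {U} ((λ _ → id) , (λ _ → id)) y∉U , W-basis

corollary2p8 : {c ℓ : Level} (R : CommutativeRing c ℓ) → IsField R
    → (q : ℕ) → IsPrimePower q → HasCardinality R q
    → (n : ℕ) → 1 ≤ n
    → let open Linear R n in
      (ρ : Subspace → ℕ) → IsQMatroid ρ
    → (B₁ B₂ : Subspace) → IsBasis ρ B₁ → IsBasis ρ B₂ → ¬ (B₁ ≐ B₂)
    → (y : Vect) → y ∈ₛ B₂ → ¬ (y ∈ₛ B₁)
    → Σ Subspace λ U → Σ Vect λ x →
        x ∈ₛ B₁ × ¬ (x ∈ₛ B₂)
      × (∀ v → v ∈ₛ B₁ → v ∈ₛ B₂ → v ∈ₛ U)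
      × IsDirectSumLine B₁ U x
      × Σ Subspace λ W → IsDirectSumLine W U y × IsBasis ρ W
corollary2p8 R isField q _ card n _ ρ isQMatroid B₁ B₂ B₁-basis B₂-basis _ y y∈B₂ y∉B₁ =
  Space.Rank.q-basis-exchange R isField card n ρ isQMatroid B₁-basis B₂-basis y∈B₂ y∉B₁
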